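{- Let $\omega\in A^{\mathbb N}$ and $k\in\mathbb{Z}^+\cup\{+\infty\}$. If $\rho^{(k)}_\omega(n_0)<q^{(k)}(n_0)$ for some $n_0\ge1$, where $q^{(k)}(n)=n+1$ for $n\le 2k-1$ and $q^{(k)}(n)=2k$ for $n\ge 2k$, then $\omega$ is ultimately periodic.
   Context: For $k\in\mathbb{Z}^+\cup\{+\infty\}$ define the relation $\mathcal R_k$ on $A^*$: $u\,\mathcal R_k\,v$ iff $u$ and $v$ are Abelian equivalent (i.e. $|u|_a=|v|_a$ for every letter $a$) and $u,v$ share a common prefix and a common suffix of length $k-1$; if $|u|<k-1$ (in particular always when $k=+\infty$), $u\,\mathcal R_k\,v$ means $u=v$. For $\omega\in A^{\mathbb N}$, $\rho^{(k)}_\omega(n)$ is the number of $\mathcal R_k$-equivalence classes of factors of $\omega$ of length $n$. $\omega=a_0a_1\cdots$ is ultimately periodic if there is $p\ge1$ with $a_{i+p}=a_i$ for all sufficiently large $i$. When $k=+\infty$, $q^{(k)}(n)=n+1$ for all $n$. -}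

module Defs where

open import Data.Nat using (ℕ; zero; suc; _+_; _*_; _∸_; _≤_; _<_; _≤ᵇ_)
open import Data.Fin using (Fin)
open import Data.Fin.Properties using () renaming (_≟_ to _≟ᶠ_)
open import Data.List using (List; []; _∷_; length; take; drop)
open import Data.List.Relation.Unary.Any using (Any)
open import Data.Product using (Σ; ∃; _×_)
open import Data.Sum using (_⊎_)
open import Data.Unit using (⊤)
open import Data.Bool using (if_then_else_)
open import Relation.Nullary using (yes; no)
open import Relation.Binary.PropositionalEquality using (_≡_)

data ℕ∞ : Set where
  fin : ℕ → ℕ∞
  ∞   : ℕ∞

Positive : ℕ∞ → Set
Positive (fin k) = 1 ≤ k
Positive ∞       = ⊤

count : ∀ {m} → Fin m → List (Fin m) → ℕ
count a []      = 0
count a (x ∷ u) with x ≟ᶠ a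
... | yes _ = suc (count a u)
... | no  _ = count a u

AbelianEq : ∀ {m} → List (Fin m) → List (Fin m) → Set
AbelianEq {m} u v = (a : Fin m) → count a u ≡ count a v

suffix : ∀ {m} → ℕ → List (Fin m) → List (Fin m)
suffix j u = drop (length u ∸ j) u

R : ∀ {m} → ℕ∞ → List (Fin m) → List (Fin m) → Set
R (fin k) u v =
    (length u < k ∸ 1 × u ≡ v)
  ⊎ (k ∸ 1 ≤ length u × AbelianEq u v
       × take (k ∸ 1) u ≡ take (k ∸ 1) v
       × suffix (k ∸ 1) u ≡ suffix (k ∸ 1) v)
R ∞ u v = u ≡ v

factor : ∀ {m} → (ℕ → Fin m) → ℕ → ℕ → List (Fin m)
factor ω i zero    = []
factor ω i (suc n) = ω i ∷ factor ω (suc i) n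

q : ℕ∞ → ℕ → ℕ
q (fin k) n = if n ≤ᵇ (2 * k ∸ 1) then suc n else 2 * k
q ∞       n = suc n

-- ρ^(k)_ω(n) < c : the factors of length n of ω fall into fewer than c
-- R_k-classes, i.e. there is a list of fewer than c positions whose factors
-- of length n represent every R_k-class of factors of length n.
ρ<[_,_,_]_ : ∀ {m} → ℕ∞ → (ℕ → Fin m) → ℕ → ℕ → Set
ρ<[ k , ω , n ] c =
  Σ (List ℕ) λ reps → length reps < c ×
    ((j : ℕ) → Any (λ i → R k (factor ω j n) (factor ω i n)) reps)

UltPeriodic : ∀ {m} → (ℕ → Fin m) → Set
UltPeriodic ω = Σ ℕ λ p → 1 ≤ p × Σ ℕ λ N → (i : ℕ) → N ≤ i → ω (i + p) ≡ ω i

-- Grouping positions by the R_k-class of their factor of length n refines the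
-- last term of a chain of refining equivalences with q⁽ᵏ⁾(n) terms.  For n ≤ 2k - 2
-- (or k = ∞) R_k is equality and the chain is "same first t letters",
-- t = 0, …, n.  For n = d + k - 1 ≥ 2k - 1 it is "same first t letters" for
-- t < k, followed by "moreover the same Parikh vector of the first d letters
-- and the same first b letters after them", b = 0, …, k - 1.  With fewer than
-- q⁽ᵏ⁾(n) classes some link of the chain adds no class, and every such stall
-- says that the factor of some length w determines the letter after it; two
-- positions with the same factor of length w (pigeonhole) then start the same
-- tail.
module Submission where

open import Defs
open import Data.Nat using (ℕ; zero; suc; _+_; _*_; _∸_; _^_; _≤_; _<_; z≤n; s≤s; _≤?_; _≤ᵇ_)
open import Data.Nat.Properties
open import Data.Fin using (Fin; toℕ; combine)
open import Data.Fin.Properties using (pigeonhole; combine-injective) renaming (_≟_ to _≟ᶠ_; all? to allFin?)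
open import Data.List using (List; []; _∷_; [_]; length; take; drop; _++_)
open import Data.List.Properties using (≡-dec; ∷-injectiveˡ; ∷-injectiveʳ; take++drop≡id; drop-drop)
open import Data.List.Relation.Unary.Any as Any using (Any; here; there; any?)
open import Data.List.Relation.Unary.All using (lookupAny)
open import Data.List.Relation.Unary.All.Properties using (¬Any⇒All¬)
open import Data.List.Relation.Unary.AllPairs using (AllPairs; []; _∷_)
open import Data.Product using (∃; _×_; _,_; proj₁; proj₂)
open import Data.Sum using (_⊎_; inj₁; inj₂)
open import Data.Bool using (true; false; T)
open import Data.Unit using (tt)
open import Data.Empty using (⊥-elim)
open import Function using (_∘_; _on_)
open import Level using (Level)
open import Relation.Nullary using (¬_; yes; no; contradiction)
open import Relation.Binary using (Rel; _⇒_; IsEquivalence; IsDecEquivalence)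
open import Relation.Binary.Construct.Intersection as ∩ using (_∩_)
import Relation.Binary.Construct.On as On
open import Relation.Binary.PropositionalEquality hiding ([_])
import Relation.Binary.PropositionalEquality.Properties as ≡

private
  variable
    a r : Level
    A : Set a

Covers : Rel A r → List A → Set _
Covers E L = ∀ x → Any (E x) L

covers-nonempty : ∀ {E : Rel A r} {L} → A → Covers E L → 0 < length L
covers-nonempty {L = _ ∷ _} _ _ = s≤s z≤n
covers-nonempty {L = []} x cover with cover x
... | ()

covers-map : ∀ {E F : Rel A r} {L} → E ⇒ F → Covers E L → Covers F L
covers-map E⇒F cover x = Any.map E⇒F (cover x)

module Refinement {E F : Rel A r}
                  (E-isDecEquivalence : IsDecEquivalence E)
                  (F-isEquivalence : IsEquivalence F)
                  (F⇒E : F ⇒ E) where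

  open IsDecEquivalence E-isDecEquivalence
    renaming (sym to E-sym; trans to E-trans; _≟_ to _≟E_)
  open IsEquivalence F-isEquivalence renaming (sym to F-sym; trans to F-trans)

  prune : (L : List A) →
          (∃ λ L′ → length L′ < length L × (∀ {x} → Any (E x) L → Any (E x) L′))
          ⊎ AllPairs (λ u v → ¬ E u v) L
  prune [] = inj₂ []
  prune (u ∷ L) with any? (u ≟E_) L
  ... | yes u∼L =
        inj₁ (L , ≤-refl , λ { (here x∼u) → Any.map (E-trans x∼u) u∼L ; (there x∼L) → x∼L })
  ... | no  u≁L with prune L
  ...   | inj₂ distinct = inj₂ (¬Any⇒All¬ L u≁L ∷ distinct)
  ...   | inj₁ (L′ , L′<L , keep) =
            inj₁ (u ∷ L′ , s≤s L′<L , λ { (here x∼u) → here x∼u ; (there x∼L) → there (keep x∼L) })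

  distinct-reflects : ∀ {L x y} → AllPairs (λ u v → ¬ E u v) L →
                      Any (F x) L → Any (F y) L → E x y → F x y
  distinct-reflects (_ ∷ _) (here x∼u) (here y∼u) _ = F-trans x∼u (F-sym y∼u)
  distinct-reflects (u≁L ∷ _) (here x∼u) (there y∼L) x∼y with lookupAny u≁L y∼L
  ... | u≁v , y∼v = ⊥-elim (u≁v (E-trans (E-sym (F⇒E x∼u)) (E-trans x∼y (F⇒E y∼v))))
  distinct-reflects (u≁L ∷ _) (there x∼L) (here y∼u) x∼y with lookupAny u≁L x∼L
  ... | u≁v , x∼v = ⊥-elim (u≁v (E-trans (E-sym (F⇒E y∼u)) (E-trans (E-sym x∼y) (F⇒E x∼v))))
  distinct-reflects (_ ∷ distinct) (there x∼L) (there y∼L) x∼y =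
    distinct-reflects distinct x∼L y∼L x∼y

  coarsen-or-coincide : ∀ L → Covers F L →
                        (∃ λ L′ → Covers E L′ × length L′ < length L) ⊎ E ⇒ F
  coarsen-or-coincide L cover with prune L
  ... | inj₁ (L′ , L′<L , keep) = inj₁ (L′ , keep ∘ Any.map F⇒E ∘ cover , L′<L)
  ... | inj₂ distinct = inj₂ λ {x} {y} → distinct-reflects distinct (cover x) (cover y)

module Chain (E : ℕ → Rel A r)
             (E-isDecEquivalence : ∀ t → IsDecEquivalence (E t))
             (E-antitone : ∀ t → E (suc t) ⇒ E t) where

  descend : ∀ t L → Covers (E t) L →
            (∃ λ s → E s ⇒ E (suc s)) ⊎ (∃ λ L₀ → Covers (E 0) L₀ × t + length L₀ ≤ length L)
  descend zero L cover = inj₂ (L , cover , ≤-refl)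
  descend (suc t) L cover
    with Refinement.coarsen-or-coincide (E-isDecEquivalence t)
           (IsDecEquivalence.isEquivalence (E-isDecEquivalence (suc t))) (E-antitone t) L cover
  ... | inj₂ stall = inj₁ (t , stall)
  ... | inj₁ (L′ , cover′ , L′<L) with descend t L′ cover′
  ...   | inj₁ stall = inj₁ stall
  ...   | inj₂ (L₀ , cover₀ , size) = inj₂ (L₀ , cover₀ , ≤-trans (s≤s size) L′<L)

drop-via-suffix : ∀ {m} ℓ (w : List (Fin m)) → length w ≤ ℓ + ℓ →
                  drop ℓ w ≡ drop (ℓ ∸ (length w ∸ ℓ)) (suffix ℓ w)
drop-via-suffix ℓ w short = begin
  drop ℓ w                 ≡⟨ cong (λ n → drop n w) (m+[n∸m]≡n c≤ℓ) ⟨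
  drop (c + (ℓ ∸ c)) w     ≡⟨ drop-drop c (ℓ ∸ c) w ⟨
  drop (ℓ ∸ c) (drop c w)  ∎
  where
    open ≡-Reasoning
    c = length w ∸ ℓ
    c≤ℓ = m≤n+o⇒m∸n≤o (length w) ℓ short

R-short⇒≡ : ∀ {m} ℓ {u v : List (Fin m)} → length u ≡ length v → length u ≤ ℓ + ℓ →
            R (fin (suc ℓ)) u v → u ≡ v
R-short⇒≡ ℓ _ _ (inj₁ (_ , u≡v)) = u≡v
R-short⇒≡ ℓ {u} {v} |u|≡|v| short (inj₂ (_ , _ , pre , suf)) = begin
  u                    ≡⟨ take++drop≡id ℓ u ⟨
  take ℓ u ++ drop ℓ u ≡⟨ cong₂ _++_ pre tails ⟩
  take ℓ v ++ drop ℓ v ≡⟨ take++drop≡id ℓ v ⟩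
  v                    ∎
  where
    open ≡-Reasoning
    tails : drop ℓ u ≡ drop ℓ v
    tails = begin
      drop ℓ u                                ≡⟨ drop-via-suffix ℓ u short ⟩
      drop (ℓ ∸ (length u ∸ ℓ)) (suffix ℓ u)  ≡⟨ cong (drop (ℓ ∸ (length u ∸ ℓ))) suf ⟩
      drop (ℓ ∸ (length u ∸ ℓ)) (suffix ℓ v)  ≡⟨ cong (λ n → drop (ℓ ∸ (n ∸ ℓ)) (suffix ℓ v)) |u|≡|v| ⟩
      drop (ℓ ∸ (length v ∸ ℓ)) (suffix ℓ v)  ≡⟨ drop-via-suffix ℓ v (subst (_≤ ℓ + ℓ) |u|≡|v| short) ⟨
      drop ℓ v                                ∎

module _ {m : ℕ} where

  count-++ : ∀ (a : Fin m) u v → count a (u ++ v) ≡ count a u + count a v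
  count-++ a []      v = refl
  count-++ a (x ∷ u) v with x ≟ᶠ a
  ... | yes _ = cong suc (count-++ a u v)
  ... | no  _ = count-++ a u v

  AbelianEq-isDecEquivalence : IsDecEquivalence (AbelianEq {m})
  AbelianEq-isDecEquivalence = record
    { isEquivalence = record
      { refl  = λ _ → refl
      ; sym   = λ u∼v a → sym (u∼v a)
      ; trans = λ u∼v v∼w a → trans (u∼v a) (v∼w a)
      }
    ; _≟_ = λ u v → allFin? λ a → count a u ≟ count a v
    }

  ≡⇒AbelianEq : {u v : List (Fin m)} → u ≡ v → AbelianEq u v
  ≡⇒AbelianEq refl _ = refl

  AbelianEq-++ : {u u′ v v′ : List (Fin m)} →
                 AbelianEq u u′ → AbelianEq v v′ → AbelianEq (u ++ v) (u′ ++ v′)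
  AbelianEq-++ {u} {u′} {v} {v′} u∼u′ v∼v′ a = begin
    count a (u ++ v)              ≡⟨ count-++ a u v ⟩
    count a u + count a v         ≡⟨ cong₂ _+_ (u∼u′ a) (v∼v′ a) ⟩
    count a u′ + count a v′       ≡⟨ count-++ a u′ v′ ⟨
    count a (u′ ++ v′)            ∎
    where open ≡-Reasoning

  AbelianEq-cancelˡ : {u u′ v v′ : List (Fin m)} →
                      AbelianEq u u′ → AbelianEq (u ++ v) (u′ ++ v′) → AbelianEq v v′
  AbelianEq-cancelˡ {u} {u′} {v} {v′} u∼u′ uv∼u′v′ a = +-cancelˡ-≡ (count a u) _ _ (begin
    count a u + count a v         ≡⟨ count-++ a u v ⟨
    count a (u ++ v)              ≡⟨ uv∼u′v′ a ⟩
    count a (u′ ++ v′)            ≡⟨ count-++ a u′ v′ ⟩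
    count a u′ + count a v′       ≡⟨ cong (_+ count a v′) (u∼u′ a) ⟨
    count a u + count a v′        ∎)
    where open ≡-Reasoning

  AbelianEq-cancelʳ : {u u′ v v′ : List (Fin m)} →
                      AbelianEq v v′ → AbelianEq (u ++ v) (u′ ++ v′) → AbelianEq u u′
  AbelianEq-cancelʳ {u} {u′} {v} {v′} v∼v′ uv∼u′v′ a = +-cancelʳ-≡ (count a v) _ _ (begin
    count a u + count a v         ≡⟨ count-++ a u v ⟨
    count a (u ++ v)              ≡⟨ uv∼u′v′ a ⟩
    count a (u′ ++ v′)            ≡⟨ count-++ a u′ v′ ⟩
    count a u′ + count a v′       ≡⟨ cong (count a u′ +_) (v∼v′ a) ⟨
    count a u′ + count a v        ∎)
    where open ≡-Reasoning

  AbelianEq-[_] : {x y : Fin m} → AbelianEq [ x ] [ y ] → x ≡ y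
  AbelianEq-[_] {x} {y} x∼y with y ≟ᶠ x | x∼y x
  ... | yes y≡x | _ = sym y≡x
  ... | no  _   | 1≡0 with x ≟ᶠ x
  ...   | yes _   = contradiction 1≡0 λ ()
  ...   | no  x≢x = contradiction refl x≢x

module _ {m : ℕ} (ω : ℕ → Fin m) where

  factor-+ : ∀ i p q → factor ω i (p + q) ≡ factor ω i p ++ factor ω (i + p) q
  factor-+ i zero    q rewrite +-identityʳ i = refl
  factor-+ i (suc p) q rewrite +-suc i p     = cong (ω i ∷_) (factor-+ (suc i) p q)

  factor-snoc : ∀ i n → factor ω i (suc n) ≡ factor ω i n ++ [ ω (i + n) ]
  factor-snoc i zero    rewrite +-identityʳ i = refl
  factor-snoc i (suc n) rewrite +-suc i n     = cong (ω i ∷_) (factor-snoc (suc i) n)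

  length-factor : ∀ i n → length (factor ω i n) ≡ n
  length-factor i zero    = refl
  length-factor i (suc n) = cong suc (length-factor (suc i) n)

  take-factor : ∀ i {t n} → t ≤ n → take t (factor ω i n) ≡ factor ω i t
  take-factor i {zero}          _         = refl
  take-factor i {suc t} {suc n} (s≤s t≤n) = cong (ω i ∷_) (take-factor (suc i) t≤n)

  drop-factor : ∀ i p q → drop p (factor ω i (p + q)) ≡ factor ω (i + p) q
  drop-factor i zero    q rewrite +-identityʳ i = refl
  drop-factor i (suc p) q rewrite +-suc i p     = drop-factor (suc i) p q

  suffix-factor : ∀ i d ℓ → suffix ℓ (factor ω i (d + ℓ)) ≡ factor ω (i + d) ℓ
  suffix-factor i d ℓ = begin
    drop (length (factor ω i (d + ℓ)) ∸ ℓ) (factor ω i (d + ℓ))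
      ≡⟨ cong (λ n → drop (n ∸ ℓ) (factor ω i (d + ℓ))) (length-factor i (d + ℓ)) ⟩
    drop (d + ℓ ∸ ℓ) (factor ω i (d + ℓ))
      ≡⟨ cong (λ n → drop n (factor ω i (d + ℓ))) (m+n∸n≡m d ℓ) ⟩
    drop d (factor ω i (d + ℓ))
      ≡⟨ drop-factor i d ℓ ⟩
    factor ω (i + d) ℓ ∎
    where open ≡-Reasoning

  Agree : ℕ → Rel ℕ _
  Agree n i j = factor ω i n ≡ factor ω j n

  Agree-isDecEquivalence : ∀ n → IsDecEquivalence (Agree n)
  Agree-isDecEquivalence n =
    On.isDecEquivalence (λ i → factor ω i n) (≡.isDecEquivalence (≡-dec _≟ᶠ_))

  agree-take : ∀ {t n} → t ≤ n → Agree n ⇒ Agree t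
  agree-take {t} t≤n {i} {j} same =
    trans (sym (take-factor i t≤n)) (trans (cong (take t) same) (take-factor j t≤n))

  agree-drop : ∀ p {q i j} → Agree (p + q) i j → Agree q (i + p) (j + p)
  agree-drop p {q} {i} {j} same =
    trans (sym (drop-factor i p q)) (trans (cong (drop p) same) (drop-factor j p q))

  agree-++ : ∀ p {q i j} → Agree p i j → Agree q (i + p) (j + p) → Agree (p + q) i j
  agree-++ p {q} {i} {j} front back =
    trans (factor-+ i p q) (trans (cong₂ _++_ front back) (sym (factor-+ j p q)))

  agree-head : ∀ {n i j} → Agree (suc n) i j → ω i ≡ ω j
  agree-head = ∷-injectiveˡ

  agree-tail : ∀ {n i j} → Agree (suc n) i j → Agree n (suc i) (suc j)
  agree-tail = ∷-injectiveʳ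

  R-short⇒agree : ∀ ℓ {n i j} → n ≤ ℓ + ℓ →
                     R (fin (suc ℓ)) (factor ω i n) (factor ω j n) → Agree n i j
  R-short⇒agree ℓ {n} {i} {j} short =
    R-short⇒≡ ℓ (trans (length-factor i n) (sym (length-factor j n)))
                (subst (_≤ ℓ + ℓ) (sym (length-factor i n)) short)

  code : ∀ n → ℕ → Fin (m ^ n)
  code zero    _ = Data.Fin.zero
  code (suc n) i = combine (ω i) (code n (suc i))

  code-injective : ∀ n {i j} → code n i ≡ code n j → Agree n i j
  code-injective zero    _ = refl
  code-injective (suc n) {i} {j} same with combine-injective (ω i) _ (ω j) _ same
  ... | heads , rests = cong₂ _∷_ heads (code-injective n rests)

  ultPeriodic-of-shift : ∀ {i j} → i < j → (∀ s → ω (s + i) ≡ ω (s + j)) → UltPeriodic ω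
  ultPeriodic-of-shift {i} {j} i<j same = j ∸ i , m<n⇒0<n∸m i<j , i , periodic
    where
      periodic : ∀ z → i ≤ z → ω (z + (j ∸ i)) ≡ ω z
      periodic z i≤z = begin
        ω (z + (j ∸ i))  ≡⟨ cong ω (trans (sym (+-∸-comm j i≤z)) (+-∸-assoc z (<⇒≤ i<j))) ⟨
        ω (z ∸ i + j)    ≡⟨ same (z ∸ i) ⟨
        ω (z ∸ i + i)    ≡⟨ cong ω (m∸n+n≡m i≤z) ⟩
        ω z              ∎
        where open ≡-Reasoning

  ultPeriodic-of-stall : ∀ w → Agree w ⇒ Agree (suc w) → UltPeriodic ω
  ultPeriodic-of-stall w stall with pigeonhole (n<1+n (m ^ w)) (code w ∘ toℕ)
  ... | x , y , x<y , same = ultPeriodic-of-shift x<y λ s → agree-head (stall (shifted s))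
    where
      shifted : ∀ s → Agree w (s + toℕ x) (s + toℕ y)
      shifted zero    = code-injective w same
      shifted (suc s) = agree-tail (stall (shifted s))

  ultPeriodic-of-agree-cover : ∀ n L → Covers (Agree n) L → length L ≤ n → UltPeriodic ω
  ultPeriodic-of-agree-cover n L cover small
    with Chain.descend Agree Agree-isDecEquivalence (λ t → agree-take (n≤1+n t)) n L cover
  ... | inj₁ (w , stall) = ultPeriodic-of-stall w stall
  ... | inj₂ (L₀ , cover₀ , size) =
        contradiction (≤-trans (+-monoʳ-≤ n (covers-nonempty 0 cover₀)) (≤-trans size small))
                      (m+1+n≰m n)

  Parikh : ℕ → Rel ℕ _
  Parikh d i j = AbelianEq (factor ω i d) (factor ω j d)

  Approx : (ℓ d b : ℕ) → Rel ℕ _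
  Approx ℓ d b = Agree ℓ ∩ Parikh d ∩ (Agree b on (_+ d))

  Approx-isDecEquivalence : ∀ ℓ d b → IsDecEquivalence (Approx ℓ d b)
  Approx-isDecEquivalence ℓ d b =
    ∩.isDecEquivalence
      (∩.isDecEquivalence (Agree-isDecEquivalence ℓ)
                          (On.isDecEquivalence (λ i → factor ω i d) AbelianEq-isDecEquivalence))
      (On.isDecEquivalence (_+ d) (Agree-isDecEquivalence b))

  approx-antitone : ∀ {ℓ d} b → Approx ℓ d (suc b) ⇒ Approx ℓ d b
  approx-antitone b (front , back) = front , agree-take (n≤1+n b) back

  agree⇒approx : ∀ {ℓ d b} → ℓ ≤ d → Agree (d + b) ⇒ Approx ℓ d b
  agree⇒approx {d = d} {b} ℓ≤d same =
    (agree-take (≤-trans ℓ≤d (m≤m+n d b)) same , ≡⇒AbelianEq (agree-take (m≤m+n d b) same)) ,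
    agree-drop d same

  R⇒approx : ∀ ℓ d {i j} → R (fin (suc ℓ)) (factor ω i (d + ℓ)) (factor ω j (d + ℓ)) →
             Approx ℓ d ℓ i j
  R⇒approx ℓ d {i} (inj₁ (short , _)) =
    contradiction (subst (_< ℓ) (length-factor i (d + ℓ)) short) (≤⇒≯ (m≤n+m ℓ d))
  R⇒approx ℓ d {i} {j} (inj₂ (_ , abelian , pre , suf)) = (prefix , parikh) , suffix′
    where
      prefix : Agree ℓ i j
      prefix = trans (sym (take-factor i (m≤n+m ℓ d))) (trans pre (take-factor j (m≤n+m ℓ d)))
      suffix′ : Agree ℓ (i + d) (j + d)
      suffix′ = trans (sym (suffix-factor i d ℓ)) (trans suf (suffix-factor j d ℓ))
      parikh : Parikh d i j
      parikh = AbelianEq-cancelʳ {u = factor ω i d} {factor ω j d} (≡⇒AbelianEq suffix′)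
                 (subst₂ AbelianEq (factor-+ i d ℓ) (factor-+ j d ℓ) abelian)

  stall-in-suffix : ∀ {ℓ d b} → ℓ ≤ d → Approx ℓ d b ⇒ Approx ℓ d (suc b) →
                    Agree (d + b) ⇒ Agree (suc (d + b))
  stall-in-suffix {d = d} {b} ℓ≤d stall {i} {j} same =
    subst (λ n → Agree n i j) (+-suc d b)
      (agree-++ d (agree-take (m≤m+n d b) same) (proj₂ (stall (agree⇒approx ℓ≤d same))))

  -- The Parikh vectors at i + 1 and j + 1 agree because their prefixes of
  -- length ℓ do (this is where d > ℓ is needed); adding the common letter at i
  -- and cancelling the common factor of length d leaves the letter at i + d.
  stall-at-parikh : ∀ {ℓ d} → suc ℓ ≤ d → Agree ℓ ⇒ Parikh d → Agree d ⇒ Agree (suc d)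
  stall-at-parikh {ℓ} {d} ℓ<d stall {i} {j} same = begin
    factor ω i (suc d)            ≡⟨ factor-snoc i d ⟩
    factor ω i d ++ [ ω (i + d) ] ≡⟨ cong₂ (λ u x → u ++ [ x ]) same next ⟩
    factor ω j d ++ [ ω (j + d) ] ≡⟨ factor-snoc j d ⟨
    factor ω j (suc d)            ∎
    where
      open ≡-Reasoning
      front : Agree (suc ℓ) i j
      front = agree-take ℓ<d same
      shifted : AbelianEq (factor ω i (suc d)) (factor ω j (suc d))
      shifted = AbelianEq-++ {u = [ ω i ]} {[ ω j ]} (≡⇒AbelianEq (cong [_] (agree-head front)))
                  (stall (agree-tail front))
      next : ω (i + d) ≡ ω (j + d)
      next = AbelianEq-[ AbelianEq-cancelˡ {u = factor ω i d} {factor ω j d} (≡⇒AbelianEq same)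
                           (subst₂ AbelianEq (factor-snoc i d) (factor-snoc j d) shifted) ]

  ultPeriodic-of-approx-cover : ∀ ℓ d → suc ℓ ≤ d → ∀ L → Covers (Approx ℓ d ℓ) L →
                                length L ≤ suc (ℓ + ℓ) → UltPeriodic ω
  ultPeriodic-of-approx-cover ℓ d ℓ<d L cover size
    with Chain.descend (Approx ℓ d) (Approx-isDecEquivalence ℓ d) approx-antitone ℓ L cover
  ... | inj₁ (b , stall) = ultPeriodic-of-stall (d + b) (stall-in-suffix (<⇒≤ ℓ<d) stall)
  ... | inj₂ (L₀ , cover₀ , size₀)
    with Refinement.coarsen-or-coincide (Agree-isDecEquivalence ℓ)
           (IsDecEquivalence.isEquivalence (Approx-isDecEquivalence ℓ d 0)) (proj₁ ∘ proj₁) L₀ cover₀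
  ...   | inj₂ coincide = ultPeriodic-of-stall d (stall-at-parikh ℓ<d (proj₂ ∘ proj₁ ∘ coincide))
  ...   | inj₁ (L₁ , cover₁ , L₁<L₀) =
          ultPeriodic-of-agree-cover ℓ L₁ cover₁ (≤-pred (≤-trans L₁<L₀ L₀≤1+ℓ))
    where
      L₀≤1+ℓ : length L₀ ≤ suc ℓ
      L₀≤1+ℓ = +-cancelˡ-≤ ℓ _ _ (≤-trans size₀ (subst (length L ≤_) (sym (+-suc ℓ ℓ)) size))

2*[1+ℓ]∸1≡1+ℓ+ℓ : ∀ ℓ → 2 * suc ℓ ∸ 1 ≡ suc (ℓ + ℓ)
2*[1+ℓ]∸1≡1+ℓ+ℓ ℓ = trans (+-suc ℓ (ℓ + 0)) (cong (λ t → suc (ℓ + t)) (+-identityʳ ℓ))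

q-short : ∀ ℓ {n} → n ≤ ℓ + ℓ → q (fin (suc ℓ)) n ≡ suc n
q-short ℓ {n} short with n ≤ᵇ (2 * suc ℓ ∸ 1) in test
... | true  = refl
... | false = contradiction (≤⇒≤ᵇ (subst (n ≤_) (sym (2*[1+ℓ]∸1≡1+ℓ+ℓ ℓ)) (m≤n⇒m≤1+n short)))
                            (subst T test)

q-bounded : ∀ ℓ n → q (fin (suc ℓ)) n ≤ suc (suc (ℓ + ℓ))
q-bounded ℓ n with n ≤ᵇ (2 * suc ℓ ∸ 1) in test
... | true  = s≤s (subst (n ≤_) (2*[1+ℓ]∸1≡1+ℓ+ℓ ℓ) (≤ᵇ⇒≤ n _ (subst T (sym test) tt)))
... | false = ≤-reflexive (cong suc (2*[1+ℓ]∸1≡1+ℓ+ℓ ℓ))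

long-split : ∀ ℓ n → ¬ n ≤ ℓ + ℓ → ∃ λ d → suc ℓ ≤ d × d + ℓ ≡ n
long-split ℓ n long = n ∸ ℓ , m+n≤o⇒m≤o∸n (suc ℓ) 2ℓ<n , m∸n+n≡m (≤-trans (m≤n+m ℓ (suc ℓ)) 2ℓ<n)
  where
    2ℓ<n : suc ℓ + ℓ ≤ n
    2ℓ<n = ≰⇒> long

theorem16 : (m : ℕ) (ω : ℕ → Fin m) (k : ℕ∞) → Positive k →
    (n₀ : ℕ) → 1 ≤ n₀ → ρ<[ k , ω , n₀ ] (q k n₀) → UltPeriodic ω
theorem16 m ω (fin zero) () _ _ _
theorem16 m ω (fin (suc ℓ)) _ n _ (L , size , cover) with n ≤? ℓ + ℓ
... | yes short =
  ultPeriodic-of-agree-cover ω n L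
    (covers-map (R-short⇒agree ω ℓ short) cover)
    (≤-pred (subst (length L <_) (q-short ℓ short) size))
... | no long with long-split ℓ n long
...   | d , ℓ<d , refl =
  ultPeriodic-of-approx-cover ω ℓ d ℓ<d L (covers-map (R⇒approx ω ℓ d) cover)
    (≤-pred (≤-trans size (q-bounded ℓ (d + ℓ))))
theorem16 m ω ∞ _ n _ (L , size , cover) = ultPeriodic-of-agree-cover ω n L cover (≤-pred size)
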